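{- Let $\varphi$ be a formula and $M$ a structure. If $\varphi$ is positive, then $\|cogen(\varphi)\|_M=\mathcal V$; if $\varphi$ is negative, then $\|gen(\varphi)\|_M=\mathcal V$.
   Context: Language: finite set $\mathcal R$ of relation symbols with arities $\delta(r)$; finite linearly ordered set $\mathcal X$ of variables. Formulas: $1$; $r(x_1,\ldots,x_n)$; $(x\approx y)$; $\neg\varphi$; $\varphi\wedge\psi$; $\varphi\vee\psi$; $(\exists x)\varphi$; $\mathrm{FV}$ = free variables; for $X=\{x_1<\cdots<x_n\}$, $(\exists X)\varphi$ abbreviates $(\exists x_1)\cdots(\exists x_n)\varphi$. A structure $M$: nonempty finite set $M$ with $r^M\subseteq M^{\delta(r)}$. $\mathcal V=M^{\mathcal X}$, $\overline V=\mathcal V\setminus V$, $\mathrm C_x(V)=\{v:\exists u\in V,\ u(z)=v(z)\ \forall z\neq x\}$, $\mathrm D_{xy}=\{v:v(x)=v(y)\}$. Value: $\|1\|=\mathcal V$, $\|r(x_1,\ldots,x_n)\|=\{v:(v(x_1),\ldots,v(x_n))\in r^M\}$, $\|x\approx y\|=\mathrm D_{xy}$, $\|\neg\varphi\|=\overline{\|\varphi\|}$, $\wedge\mapsto\cap$, $\vee\mapsto\cup$, $\|(\exists x)\varphi\|=\mathrm C_x(\|\varphi\|)$. In all recursive definitions below $\varphi\vee\psi$ is treated as $\neg(\neg\varphi\wedge\neg\psi)$. Positive formulas: every atomic formula is positive; $\neg\varphi$ is positive if $\varphi$ is not positive; $(\exists x)\varphi$ is positive if $\varphi$ is positive; $\varphi\wedge\psi$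 is positive if $\varphi$ or $\psi$ is positive. Non-positive formulas are negative. $\mathrm{Eq}(R)$ is the least equivalence on $\mathcal X$ containing $R$; $\mathrm{id}_{\mathcal X}$ the identity. $eq(1)=coeq(1)=eq(r(\ldots))=coeq(r(\ldots))=coeq(x\approx y)=\mathrm{id}_{\mathcal X}$, $eq(x_1\approx x_2)=\mathrm{Eq}(\{\langle x_1,x_2\rangle\})$; $eq(\neg\varphi)=coeq(\varphi)$, $coeq(\neg\varphi)=eq(\varphi)$; $eq(\varphi\wedge\psi)=\mathrm{Eq}(eq(\varphi)\cup eq(\psi))$, $coeq(\varphi\wedge\psi)=coeq(\varphi)\cap coeq(\psi)$; $eq((\exists x)\varphi)=\mathrm{Eq}(eq(\varphi)\cap(\mathcal X\setminus\{x\})^2)$, likewise $coeq$. $\varphi\vee^*\psi$ denotes $(\exists X\setminus Y)\varphi\vee(\exists Y\setminus X)\psi$, $X=\mathrm{FV}(\varphi)$, $Y=\mathrm{FV}(\psi)$. For each equivalence on $\mathcal X$ one inclusion-minimal generating relation is fixed. $gen(1)=cogen(1)=1$; $gen(r(\ldots))=r(\ldots)$, $cogen(r(\ldots))=1$; $gen(x\approx y)=cogen(x\approx y)=1$; $gen(\neg\varphi)=cogen(\varphi)$, $cogen(\neg\varphi)=gen(\varphi)$; $gen(\varphi\wedge\psi)=gen(\varphi)\wedge gen(\psi)\wedge(\varphi\approx_\wedge\psi)$; $cogen(\varphi\wedge\psi)=cogen(\varphi)\vee^*cogen(\psi)$; $gen((\exists x)\varphi)=(\exists x)gen(\varphi)$;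 $cogen((\exists x)\varphi)=(\exists x)cogen(\varphi)$; $(\varphi\approx_\wedge\psi)$ is $(x_1\approx y_1)\wedge\cdots\wedge(x_n\approx y_n)$ for the fixed minimal representation $\{\langle x_i,y_i\rangle\}$ of $\mathrm{Eq}(eq(\varphi\wedge\psi)\setminus eq(gen(\varphi)\wedge gen(\psi)))$, or $1$ if empty. -}

module Defs where

open import Data.Nat using (ℕ; zero; suc)
open import Data.Fin using (Fin; _≟_)
open import Data.Bool using (Bool; true; false; _∧_; _∨_; not; if_then_else_; T)
open import Data.List using (List; []; _∷_; foldr; allFin)
open import Data.Bool.ListAction using (any)
open import Data.Vec using (Vec; map; toList; lookup)
open import Data.Fin.Subset using (Subset; _∪_; _∩_; ∁; ⁅_⁆) renaming (⊥ to ∅)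
open import Data.Product using (Σ; _×_; _,_)
open import Data.Sum using (_⊎_)
open import Data.Unit using (⊤)
open import Relation.Nullary using (¬_)
open import Relation.Nullary.Decidable using (⌊_⌋)
open import Relation.Binary.PropositionalEquality using (_≡_; _≢_)

-- Language: relation symbols Fin k with arities δ; variables Fin n
-- (linearly ordered by the usual order of Fin n).

data Formula {k : ℕ} (δ : Fin k → ℕ) (n : ℕ) : Set where
  one : Formula δ n
  rel : (r : Fin k) → Vec (Fin n) (δ r) → Formula δ n
  eqv : Fin n → Fin n → Formula δ n
  neg : Formula δ n → Formula δ n
  and : Formula δ n → Formula δ n → Formula δ n
  or  : Formula δ n → Formula δ n → Formula δ n
  ex  : Fin n → Formula δ n → Formula δ n

module _ {k : ℕ} {δ : Fin k → ℕ} {n : ℕ} where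

  -- positivity (φ ∨ ψ treated as ¬(¬φ ∧ ¬ψ))
  pos : Formula δ n → Bool
  pos one = true
  pos (rel r xs) = true
  pos (eqv x y) = true
  pos (neg φ) = not (pos φ)
  pos (and φ ψ) = pos φ ∨ pos ψ
  pos (or φ ψ) = pos φ ∧ pos ψ
  pos (ex x φ) = pos φ

  FV : Formula δ n → Subset n
  FV one = ∅
  FV (rel r xs) = foldr (λ x S → ⁅ x ⁆ ∪ S) ∅ (toList xs)
  FV (eqv x y) = ⁅ x ⁆ ∪ ⁅ y ⁆
  FV (neg φ) = FV φ
  FV (and φ ψ) = FV φ ∪ FV ψ
  FV (or φ ψ) = FV φ ∪ FV ψ
  FV (ex x φ) = FV φ ∩ ∁ ⁅ x ⁆

  -- (∃X)φ = (∃x₁)⋯(∃xₘ)φ for X = {x₁ < ⋯ < xₘ}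
  exSet : Subset n → Formula δ n → Formula δ n
  exSet X φ = foldr (λ x acc → if lookup X x then ex x acc else acc) φ (allFin n)

  orStar : Formula δ n → Formula δ n → Formula δ n
  orStar φ ψ = or (exSet (FV φ ∩ ∁ (FV ψ)) φ) (exSet (FV ψ ∩ ∁ (FV φ)) ψ)

  conjEqs : List (Fin n × Fin n) → Formula δ n
  conjEqs [] = one
  conjEqs ((x , y) ∷ []) = eqv x y
  conjEqs ((x , y) ∷ p ∷ ps) = and (eqv x y) (conjEqs (p ∷ ps))

BRel : ℕ → Set
BRel n = Fin n → Fin n → Bool

module _ {n : ℕ} where

  idR : BRel n
  idR a b = ⌊ a ≟ b ⌋

  _∪R_ _∩R_ _∖R_ : BRel n → BRel n → BRel n
  (R ∪R S) a b = R a b ∨ S a b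
  (R ∩R S) a b = R a b ∧ S a b
  (R ∖R S) a b = R a b ∧ not (S a b)

  singleR : Fin n → Fin n → BRel n
  singleR x y a b = ⌊ a ≟ x ⌋ ∧ ⌊ b ≟ y ⌋

  restrictR : Fin n → BRel n → BRel n
  restrictR x R a b = R a b ∧ (not ⌊ a ≟ x ⌋ ∧ not ⌊ b ≟ x ⌋)

  composeR : BRel n → BRel n → BRel n
  composeR R S a c = any (λ b → R a b ∧ S b c) (allFin n)

  iterR : ℕ → (BRel n → BRel n) → BRel n → BRel n
  iterR zero f R = R
  iterR (suc m) f R = iterR m f (f R)

  -- Eq(R): least equivalence containing R, computed as the transitive
  -- closure (n squarings) of the reflexive-symmetric closure of R.
  EqC : BRel n → BRel n
  EqC R = iterR n (λ S → composeR S S) (λ a b → R a b ∨ R b a ∨ idR a b)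

  pairsRel : List (Fin n × Fin n) → BRel n
  pairsRel ps a b = any (λ p → singleR (Data.Product.proj₁ p) (Data.Product.proj₂ p) a b) ps

  _⊆R_ _≐R_ : BRel n → BRel n → Set
  R ⊆R S = ∀ a b → T (R a b) → T (S a b)
  R ≐R S = (R ⊆R S) × (S ⊆R R)

  record IsEquivR (E : BRel n) : Set where
    field
      reflR  : ∀ a → T (E a a)
      symR   : ∀ a b → T (E a b) → T (E b a)
      transR : ∀ a b c → T (E a b) → T (E b c) → T (E a c)

-- The fixed choice of an inclusion-minimal generating relation for each
-- equivalence (given as a list of pairs).
RepChoice : ℕ → Set
RepChoice n = BRel n → List (Fin n × Fin n)

IsMinRep : {n : ℕ} → RepChoice n → Set
IsMinRep rep = ∀ E → IsEquivR E →
  (EqC (pairsRel (rep E)) ≐R E) ×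
  (∀ S → S ⊆R pairsRel (rep E) → EqC S ≐R E → pairsRel (rep E) ⊆R S)

module _ {k : ℕ} {δ : Fin k → ℕ} {n : ℕ} where

  eqF coeqF : Formula δ n → BRel n
  eqF one = idR
  eqF (rel r xs) = idR
  eqF (eqv x y) = EqC (singleR x y)
  eqF (neg φ) = coeqF φ
  eqF (and φ ψ) = EqC (eqF φ ∪R eqF ψ)
  eqF (or φ ψ) = eqF φ ∩R eqF ψ              -- = coeq(¬φ ∧ ¬ψ)
  eqF (ex x φ) = EqC (restrictR x (eqF φ))
  coeqF one = idR
  coeqF (rel r xs) = idR
  coeqF (eqv x y) = idR
  coeqF (neg φ) = eqF φ
  coeqF (and φ ψ) = coeqF φ ∩R coeqF ψ
  coeqF (or φ ψ) = EqC (coeqF φ ∪R coeqF ψ)  -- = eq(¬φ ∧ ¬ψ)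
  coeqF (ex x φ) = EqC (restrictR x (coeqF φ))

  module _ (rep : RepChoice n) where

    -- (φ ≈∧ ψ), given E₁ = eq(φ ∧ ψ) and E₂ = eq(gen φ ∧ gen ψ)
    approxAnd : BRel n → BRel n → Formula δ n
    approxAnd E₁ E₂ = conjEqs (rep (EqC (E₁ ∖R E₂)))

    gen cogen : Formula δ n → Formula δ n
    gen one = one
    gen (rel r xs) = rel r xs
    gen (eqv x y) = one
    gen (neg φ) = cogen φ
    gen (and φ ψ) = and (and (gen φ) (gen ψ))
                        (approxAnd (eqF (and φ ψ)) (eqF (and (gen φ) (gen ψ))))
    gen (or φ ψ) = orStar (gen φ) (gen ψ)     -- = cogen(¬φ ∧ ¬ψ)
    gen (ex x φ) = ex x (gen φ)
    cogen one = one
    cogen (rel r xs) = one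
    cogen (eqv x y) = one
    cogen (neg φ) = gen φ
    cogen (and φ ψ) = orStar (cogen φ) (cogen ψ)
    cogen (or φ ψ) = and (and (cogen φ) (cogen ψ))   -- = gen(¬φ ∧ ¬ψ)
                         (approxAnd (eqF (and (neg φ) (neg ψ))) (eqF (and (cogen φ) (cogen ψ))))
    cogen (ex x φ) = ex x (cogen φ)

record Structure {k : ℕ} (δ : Fin k → ℕ) : Set where
  field
    size : ℕ
    relM : (r : Fin k) → Vec (Fin (suc size)) (δ r) → Bool

module _ {k : ℕ} {δ : Fin k → ℕ} {n : ℕ} (M : Structure δ) where
  open Structure M

  Carrier : Set
  Carrier = Fin (suc size)

  ⟦_⟧ : Formula δ n → (Fin n → Carrier) → Set
  ⟦ one ⟧ v = ⊤
  ⟦ rel r xs ⟧ v = T (relM r (map v xs))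
  ⟦ eqv x y ⟧ v = v x ≡ v y
  ⟦ neg φ ⟧ v = ¬ ⟦ φ ⟧ v
  ⟦ and φ ψ ⟧ v = ⟦ φ ⟧ v × ⟦ ψ ⟧ v
  ⟦ or φ ψ ⟧ v = ⟦ φ ⟧ v ⊎ ⟦ ψ ⟧ v
  ⟦ ex x φ ⟧ v = Σ (Fin n → Carrier) λ u → ⟦ φ ⟧ u × (∀ z → z ≢ x → u z ≡ v z)

  ValueIsAll : Formula δ n → Set
  ValueIsAll φ = ∀ v → ⟦ φ ⟧ v

module Submission where

-- For positive φ the relation coeq(φ) is the identity, and for negative φ so
-- is eq(φ).  Hence every conjunction of equalities (φ ≈∧ ψ) that gen and cogen
-- produce at these polarities is built from the minimal generating relation of
-- the identity, which is empty, and so it is 1.  The remaining clauses only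
-- combine valid formulas by ∧, ∨* and ∃, which preserve validity.

open import Defs
open import Data.Nat using (ℕ; zero; suc)
open import Data.Fin using (Fin)
open import Data.Bool using (true; false; not; T; _∧_; _∨_; if_then_else_)
open import Data.Bool.Properties using (T-∧; T-∨; not-involutive; ∨-∧-booleanAlgebra)
open import Algebra.Lattice.Properties.BooleanAlgebra ∨-∧-booleanAlgebra using (deMorgan₁; deMorgan₂)
open import Data.List using ([]; _∷_; foldr; allFin)
open import Data.List.Relation.Unary.Any using (satisfied)
open import Data.List.Relation.Unary.Any.Properties using (any⁺; any⁻)
open import Data.List.Membership.Propositional using (lose)
open import Data.List.Membership.Propositional.Properties using (∈-allFin)
open import Data.Vec using (lookup)
open import Data.Fin.Subset using (_∩_; ∁)
open import Data.Product using (_×_; _,_; proj₁; proj₂)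
open import Data.Sum using (_⊎_; inj₁; inj₂; [_,_])
open import Data.Unit using (tt)
open import Data.Empty using (⊥-elim)
open import Function using (_∘_)
open import Function.Bundles using (Equivalence)
open import Relation.Nullary.Decidable using (toWitness; fromWitness)
open import Relation.Binary.PropositionalEquality using (_≡_; refl; sym; trans; cong; subst)

open Equivalence using (to; from)

T-not-not : ∀ {a} → T (not (not a)) → T a
T-not-not {a} = subst T (not-involutive a)

T-not-∨ : ∀ {a b} → T (not (a ∨ b)) → T (not a) × T (not b)
T-not-∨ {a} {b} = to T-∧ ∘ subst T (deMorgan₂ a b)

T-not-∧ : ∀ {a b} → T (not (a ∧ b)) → T (not a) ⊎ T (not b)
T-not-∧ {a} {b} = to T-∨ ∘ subst T (deMorgan₁ a b)

module _ {n : ℕ} where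

  record Coreflexive (R : BRel n) : Set where
    constructor coreflexive
    field
      ⇒≡ : ∀ {a b} → T (R a b) → a ≡ b

  open Coreflexive

  record ReflexiveR (R : BRel n) : Set where
    constructor reflexive
    field
      refl-at : ∀ a → T (R a a)

  open ReflexiveR

  ∅R : BRel n
  ∅R _ _ = false

  idR-coreflexive : Coreflexive idR
  idR-coreflexive = coreflexive toWitness

  idR-reflexive : ReflexiveR idR
  idR-reflexive = reflexive λ a → fromWitness refl

  ∪R-coreflexive : ∀ {R S} → Coreflexive R → Coreflexive S → Coreflexive (R ∪R S)
  ∪R-coreflexive cR cS = coreflexive ([ ⇒≡ cR , ⇒≡ cS ] ∘ to T-∨)

  ∩R-coreflexiveˡ : ∀ {R S} → Coreflexive R → Coreflexive (R ∩R S)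
  ∩R-coreflexiveˡ cR = coreflexive (⇒≡ cR ∘ proj₁ ∘ to T-∧)

  ∩R-coreflexiveʳ : ∀ {R S} → Coreflexive S → Coreflexive (R ∩R S)
  ∩R-coreflexiveʳ cS = coreflexive (⇒≡ cS ∘ proj₂ ∘ to T-∧)

  ∖R-coreflexive : ∀ {R S} → Coreflexive R → Coreflexive (R ∖R S)
  ∖R-coreflexive cR = coreflexive (⇒≡ cR ∘ proj₁ ∘ to T-∧)

  restrictR-coreflexive : ∀ {x R} → Coreflexive R → Coreflexive (restrictR x R)
  restrictR-coreflexive cR = coreflexive (⇒≡ cR ∘ proj₁ ∘ to T-∧)

  composeR-coreflexive : ∀ {R S} → Coreflexive R → Coreflexive S → Coreflexive (composeR R S)
  composeR-coreflexive cR cS = coreflexive λ h →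
    let _ , Rab∧Sbc = satisfied (any⁻ _ (allFin n) h)
        Rab , Sbc = to T-∧ Rab∧Sbc
    in trans (⇒≡ cR Rab) (⇒≡ cS Sbc)

  composeR-reflexive : ∀ {R S} → ReflexiveR R → ReflexiveR S → ReflexiveR (composeR R S)
  composeR-reflexive rR rS =
    reflexive λ a → any⁺ _ (lose (∈-allFin a) (from T-∧ (refl-at rR a , refl-at rS a)))

  iterR-preserves : (P : BRel n → Set) {f : BRel n → BRel n} →
                    (∀ {R} → P R → P (f R)) → ∀ m {R} → P R → P (iterR m f R)
  iterR-preserves P pf zero    pR = pR
  iterR-preserves P pf (suc m) pR = iterR-preserves P pf m (pf pR)

  EqC-coreflexive : ∀ {R} → Coreflexive R → Coreflexive (EqC R)
  EqC-coreflexive cR =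
    iterR-preserves Coreflexive (λ cS → composeR-coreflexive cS cS) n
      (coreflexive ([ ⇒≡ cR , [ sym ∘ ⇒≡ cR , ⇒≡ idR-coreflexive ] ∘ to T-∨ ] ∘ to T-∨))

  EqC-reflexive : ∀ R → ReflexiveR (EqC R)
  EqC-reflexive R =
    iterR-preserves ReflexiveR (λ rS → composeR-reflexive rS rS) n
      {λ a b → R a b ∨ R b a ∨ idR a b}
      (reflexive λ a → from (T-∨ {R a a}) (inj₂ (from (T-∨ {R a a}) (inj₂ (refl-at idR-reflexive a)))))

  coreflexive-reflexive-isEquivR : ∀ {E} → Coreflexive E → ReflexiveR E → IsEquivR E
  coreflexive-reflexive-isEquivR {E} cE rE = record
    { reflR  = refl-at rE
    ; symR   = λ a b Eab → subst (λ z → T (E z a)) (⇒≡ cE Eab) (refl-at rE a)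
    ; transR = λ a b c Eab Ebc → subst (λ z → T (E a z)) (⇒≡ cE Ebc) Eab
    }

  coreflexive-reflexive-⊆R : ∀ {R S} → Coreflexive R → ReflexiveR S → R ⊆R S
  coreflexive-reflexive-⊆R {S = S} cR rS a b Rab =
    subst (λ z → T (S a z)) (⇒≡ cR Rab) (refl-at rS a)

  pairsRel-⊆∅⇒[] : ∀ ps → pairsRel ps ⊆R ∅R → ps ≡ []
  pairsRel-⊆∅⇒[] []             _  = refl
  pairsRel-⊆∅⇒[] ((a , b) ∷ ps) ⊆∅ = ⊥-elim (⊆∅ a b pair∈)
    where
    pair∈ : T (pairsRel ((a , b) ∷ ps) a b)
    pair∈ = from T-∨ (inj₁ (from T-∧ (refl-at idR-reflexive a , refl-at idR-reflexive b)))

  -- ∅R generates the identity, so a minimal representation of it is empty.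
  minRep-identity≡[] : (rep : RepChoice n) → IsMinRep rep →
                       ∀ {E} → Coreflexive E → ReflexiveR E → rep E ≡ []
  minRep-identity≡[] rep minRep {E} cE rE =
    pairsRel-⊆∅⇒[] (rep E)
      (proj₂ (minRep E (coreflexive-reflexive-isEquivR cE rE)) ∅R (λ _ _ ())
        ( coreflexive-reflexive-⊆R (EqC-coreflexive {∅R} (coreflexive λ ())) rE
        , coreflexive-reflexive-⊆R cE (EqC-reflexive ∅R) ))

module _ {k : ℕ} {δ : Fin k → ℕ} {n : ℕ} where

  approxAnd-coreflexive≡one : (rep : RepChoice n) → IsMinRep rep →
                              ∀ {E₁} E₂ → Coreflexive E₁ → approxAnd {δ = δ} rep E₁ E₂ ≡ one
  approxAnd-coreflexive≡one rep minRep {E₁} E₂ cE₁ =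
    cong conjEqs (minRep-identity≡[] rep minRep (EqC-coreflexive (∖R-coreflexive cE₁))
                                                (EqC-reflexive (E₁ ∖R E₂)))

  mutual
    coeqF-coreflexive : (φ : Formula δ n) → T (pos φ) → Coreflexive (coeqF φ)
    coeqF-coreflexive one        _ = idR-coreflexive
    coeqF-coreflexive (rel r xs) _ = idR-coreflexive
    coeqF-coreflexive (eqv x y)  _ = idR-coreflexive
    coeqF-coreflexive (neg φ)    h = eqF-coreflexive φ h
    coeqF-coreflexive (and φ ψ)  h =
      [ (λ p → ∩R-coreflexiveˡ (coeqF-coreflexive φ p))
      , (λ q → ∩R-coreflexiveʳ (coeqF-coreflexive ψ q)) ] (to T-∨ h)
    coeqF-coreflexive (or φ ψ)   h =
      let p , q = to T-∧ h
      in EqC-coreflexive (∪R-coreflexive (coeqF-coreflexive φ p) (coeqF-coreflexive ψ q))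
    coeqF-coreflexive (ex x φ)   h = EqC-coreflexive (restrictR-coreflexive (coeqF-coreflexive φ h))

    eqF-coreflexive : (φ : Formula δ n) → T (not (pos φ)) → Coreflexive (eqF φ)
    eqF-coreflexive one        ()
    eqF-coreflexive (rel r xs) ()
    eqF-coreflexive (eqv x y)  ()
    eqF-coreflexive (neg φ)    h = coeqF-coreflexive φ (T-not-not h)
    eqF-coreflexive (and φ ψ)  h =
      let p , q = T-not-∨ h
      in EqC-coreflexive (∪R-coreflexive (eqF-coreflexive φ p) (eqF-coreflexive ψ q))
    eqF-coreflexive (or φ ψ)   h =
      [ (λ p → ∩R-coreflexiveˡ (eqF-coreflexive φ p))
      , (λ q → ∩R-coreflexiveʳ (eqF-coreflexive ψ q)) ] (T-not-∧ h)
    eqF-coreflexive (ex x φ)   h = EqC-coreflexive (restrictR-coreflexive (eqF-coreflexive φ h))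

module _ {k : ℕ} {δ : Fin k → ℕ} {n : ℕ} (M : Structure δ) where

  ex-valid : ∀ x (φ : Formula δ n) → ValueIsAll M φ → ValueIsAll M (ex x φ)
  ex-valid x φ φ-valid v = v , φ-valid v , λ _ _ → refl

  exSet-valid : ∀ X (φ : Formula δ n) → ValueIsAll M φ → ValueIsAll M (exSet X φ)
  exSet-valid X φ φ-valid = go (allFin n)
    where
    exIf : Fin n → Formula δ n → Formula δ n
    exIf x acc = if lookup X x then ex x acc else acc

    go : ∀ xs → ValueIsAll M (foldr exIf φ xs)
    go []       = φ-valid
    go (x ∷ xs) with lookup X x
    ... | true  = ex-valid x (foldr exIf φ xs) (go xs)
    ... | false = go xs

  orStar-validˡ : (φ ψ : Formula δ n) → ValueIsAll M φ → ValueIsAll M (orStar φ ψ)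
  orStar-validˡ φ ψ φ-valid v = inj₁ (exSet-valid (FV φ ∩ ∁ (FV ψ)) φ φ-valid v)

  orStar-validʳ : (φ ψ : Formula δ n) → ValueIsAll M ψ → ValueIsAll M (orStar φ ψ)
  orStar-validʳ φ ψ ψ-valid v = inj₂ (exSet-valid (FV ψ ∩ ∁ (FV φ)) ψ ψ-valid v)

  module _ (rep : RepChoice n) (minRep : IsMinRep rep) where

    approxAnd-valid : ∀ {E₁} E₂ → Coreflexive E₁ → ValueIsAll M (approxAnd {δ = δ} rep E₁ E₂)
    approxAnd-valid E₂ cE₁ =
      subst (ValueIsAll M) (sym (approxAnd-coreflexive≡one rep minRep E₂ cE₁)) (λ _ → tt)

    -- In the ∨-clause of cogen and the ∧-clause of gen, the first argument of
    -- approxAnd is definitionally coeqF (or φ ψ), resp. eqF (and φ ψ).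
    mutual
      cogen-valid : (φ : Formula δ n) → T (pos φ) → ValueIsAll M (cogen rep φ)
      cogen-valid one        _ _ = tt
      cogen-valid (rel r xs) _ _ = tt
      cogen-valid (eqv x y)  _ _ = tt
      cogen-valid (neg φ)    h   = gen-valid φ h
      cogen-valid (and φ ψ)  h   =
        [ (λ p → orStar-validˡ (cogen rep φ) (cogen rep ψ) (cogen-valid φ p))
        , (λ q → orStar-validʳ (cogen rep φ) (cogen rep ψ) (cogen-valid ψ q)) ] (to T-∨ h)
      cogen-valid (or φ ψ)   h   v =
        let p , q = to T-∧ h
        in (cogen-valid φ p v , cogen-valid ψ q v) , approxAnd-valid _ (coeqF-coreflexive (or φ ψ) h) v
      cogen-valid (ex x φ)   h   = ex-valid x (cogen rep φ) (cogen-valid φ h)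

      gen-valid : (φ : Formula δ n) → T (not (pos φ)) → ValueIsAll M (gen rep φ)
      gen-valid one        ()
      gen-valid (rel r xs) ()
      gen-valid (eqv x y)  ()
      gen-valid (neg φ)    h = cogen-valid φ (T-not-not h)
      gen-valid (and φ ψ)  h v =
        let p , q = T-not-∨ h
        in (gen-valid φ p v , gen-valid ψ q v) , approxAnd-valid _ (eqF-coreflexive (and φ ψ) h) v
      gen-valid (or φ ψ)   h =
        [ (λ p → orStar-validˡ (gen rep φ) (gen rep ψ) (gen-valid φ p))
        , (λ q → orStar-validʳ (gen rep φ) (gen rep ψ) (gen-valid ψ q)) ] (T-not-∧ h)
      gen-valid (ex x φ)   h = ex-valid x (gen rep φ) (gen-valid φ h)

lemma6p1 : {k : ℕ} (δ : Fin k → ℕ) (n : ℕ) (rep : RepChoice n) → IsMinRep rep →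
    (φ : Formula δ n) (M : Structure δ) →
    (T (pos φ) → ValueIsAll M (cogen rep φ)) × (T (not (pos φ)) → ValueIsAll M (gen rep φ))
lemma6p1 δ n rep minRep φ M = cogen-valid M rep minRep φ , gen-valid M rep minRep φ
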